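{- Let $G$ and $H$ be two connected graphs. If $\mu_t(G) = |\mathcal{S}(G)|$ or $\mu_t(H) = |\mathcal{S}(H)|$, then $\mu_t(G\Box H)\le \mu_t(G)\mu_t(H)$.
   Context: All graphs are finite, simple and undirected. A vertex is simplicial if its neighbours induce a complete graph; $\mathcal{S}(G)$ is the set of simplicial vertices of $G$. The Cartesian product $G\Box H$ has vertex set $V(G)\times V(H)$, with $(x,y)$ adjacent to $(x',y')$ iff either $x=x'$ and $yy'\in E(H)$, or $xx'\in E(G)$ and $y=y'$. For a graph $F$ and $X\subseteq V(F)$, two vertices $x,y$ are $X$-visible if there is a shortest $x,y$-path in $F$ none of whose internal vertices lies in $X$. $X$ is a total mutual-visibility set of $F$ if every two vertices of $F$ are $X$-visible; $\mu_t(F)$ is the maximum cardinality of such a set. -}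

module Defs where

open import Data.Nat using (ℕ; zero; suc; _*_; _≤_)
open import Data.Bool using (Bool; true; false; _∧_; _∨_)
open import Data.Fin using (Fin; remQuot)
open import Data.Fin.Properties using (_≟_)
open import Data.Fin.Subset using (Subset; _∈_; _∉_; ∣_∣)
open import Data.Product using (Σ; ∃; _×_; _,_)
open import Data.Unit using (⊤)
open import Relation.Binary.PropositionalEquality using (_≡_; _≢_)
open import Relation.Nullary.Decidable using (⌊_⌋)
open import Function.Bundles using (_⇔_)

record Graph : Set where
  constructor mkGraph
  field
    n   : ℕ
    adj : Fin n → Fin n → Bool
open Graph public

Simple : Graph → Set
Simple G = (∀ x y → adj G x y ≡ adj G y x) × (∀ x → adj G x x ≡ false)

Adj : (G : Graph) → Fin (n G) → Fin (n G) → Set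
Adj G x y = adj G x y ≡ true

data Walk (G : Graph) : Fin (n G) → Fin (n G) → ℕ → Set where
  nil  : ∀ {x} → Walk G x x 0
  cons : ∀ {x y z k} → Adj G x y → Walk G y z k → Walk G x z (suc k)

Shortest : (G : Graph) {x y : Fin (n G)} {k : ℕ} → Walk G x y k → Set
Shortest G {x} {y} {k} _ = ∀ k' → Walk G x y k' → k ≤ k'

InternalAvoid : (G : Graph) (X : Subset (n G)) {x y : Fin (n G)} {k : ℕ} →
                Walk G x y k → Set
InternalAvoid G X nil = ⊤
InternalAvoid G X (cons _ nil) = ⊤
InternalAvoid G X (cons {y = v} _ (cons e w)) = (v ∉ X) × InternalAvoid G X (cons e w)

Visible : (G : Graph) (X : Subset (n G)) → Fin (n G) → Fin (n G) → Set
Visible G X x y = Σ ℕ λ k → Σ (Walk G x y k) λ w → Shortest G w × InternalAvoid G X w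

TotalMutualVisibility : (G : Graph) → Subset (n G) → Set
TotalMutualVisibility G X = ∀ x y → Visible G X x y

IsMuT : Graph → ℕ → Set
IsMuT G m = (Σ (Subset (n G)) λ X → TotalMutualVisibility G X × ∣ X ∣ ≡ m)
          × (∀ X → TotalMutualVisibility G X → ∣ X ∣ ≤ m)

Connected : Graph → Set
Connected G = ∀ x y → Σ ℕ λ k → Walk G x y k

Simplicial : (G : Graph) → Fin (n G) → Set
Simplicial G v = ∀ y z → Adj G v y → Adj G v z → y ≢ z → Adj G y z

IsSimplicialSet : (G : Graph) → Subset (n G) → Set
IsSimplicialSet G S = ∀ v → (v ∈ S) ⇔ Simplicial G v

_□_ : Graph → Graph → Graph
G □ H = mkGraph (n G * n H) a
  where
  a : Fin (n G * n H) → Fin (n G * n H) → Bool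
  a i j with remQuot (n H) i | remQuot (n H) j
  ... | (x , y) | (x' , y') = (⌊ x ≟ x' ⌋ ∧ adj H y y') ∨ (adj G x x' ∧ ⌊ y ≟ y' ⌋)

-- A total mutual-visibility set X of G □ H meets every H-layer {g} × H in a total
-- mutual-visibility set of H, and every G-layer G × {h} in one of G: a shortest path between
-- two vertices of a layer never leaves it, since a step in the other factor can only lengthen
-- the projected path.  Simplicial vertices are never inner vertices of shortest paths, so adding
-- them keeps a set totally mutually visible; hence if μ_t(G) = |S(G)|, every such set of G lies
-- in S(G).  Then X ⊆ S(G) × V(H) with at most μ_t(H) points per H-layer, so
-- |X| ≤ |S(G)| μ_t(H) = μ_t(G) μ_t(H), and symmetrically when μ_t(H) = |S(H)|.
module Submission where

open import Defs
open import Data.Bool using (Bool; true; false; _∧_; _∨_)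
open import Data.Bool.Properties using (T-≡; T-∧; T-∨; ∨-zeroʳ)
open import Data.Empty using (⊥-elim)
open import Data.Fin using (Fin; zero; suc; combine; remQuot; _↑ˡ_; _↑ʳ_)
open import Data.Fin.Properties using (remQuot-combine; combine-remQuot) renaming (_≟_ to _≟ᶠ_)
open import Data.Fin.Subset using (Subset; Empty; _∈_; _∉_; _⊆_; _∪_; ∣_∣)
open import Data.Fin.Subset.Properties
  using (_∈?_; ∣⊥∣≡0; Empty-unique; drop-there; x∈p∪q⁻; p⊆p∪q; q⊆p∪q; p⊂q⇒∣p∣<∣q∣)
open import Data.Nat using (ℕ; zero; suc; _+_; _*_; _≤_; _<_; z≤n; s≤s)
open import Data.Nat.Properties
  using (+-*-semiring; +-mono-≤; *-comm; ≤-pred; <⇒≱; n<1+n; m<n⇒m<1+n; module ≤-Reasoning)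
open import Algebra.Properties.Semiring.Sum +-*-semiring using (sum-syntax; ∑-comm; sum-cong-≗)
open import Data.Product using (Σ; ∃; _×_; _,_; proj₁; proj₂)
open import Data.Sum using (_⊎_; inj₁; inj₂; [_,_])
open import Data.Unit using (tt)
open import Data.Vec using ([]; _∷_; lookup; tabulate)
open import Data.Vec.Properties using (tabulate∘lookup; tabulate-cong; lookup∘tabulate; []=⇒lookup; lookup⇒[]=)
open import Function using (_∘_; _⇔_; mk⇔; Equivalence)
open import Relation.Nullary using (yes; no)
open import Relation.Nullary.Decidable using (⌊_⌋; toWitness; fromWitness)
open import Relation.Binary.PropositionalEquality
  using (_≡_; refl; sym; trans; cong; cong₂; subst; subst₂; module ≡-Reasoning)

∈-tabulate∘lookup : ∀ {m n} (X : Subset m) (f : Fin n → Fin m) {x} → x ∈ tabulate (lookup X ∘ f) ⇔ f x ∈ X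
∈-tabulate∘lookup X f {x} = mk⇔
  (λ x∈ → lookup⇒[]= (f x) X (trans (sym (lookup∘tabulate (lookup X ∘ f) x)) ([]=⇒lookup x∈)))
  (λ fx∈ → lookup⇒[]= x _ (trans (lookup∘tabulate (lookup X ∘ f) x) ([]=⇒lookup fx∈)))

Empty⇒∣p∣≡0 : ∀ {n} {p : Subset n} → Empty p → ∣ p ∣ ≡ 0
Empty⇒∣p∣≡0 {n} empty = trans (cong ∣_∣ (Empty-unique empty)) (∣⊥∣≡0 n)

row : ∀ {m n} → Subset (m * n) → Fin m → Subset n
row X i = tabulate (lookup X ∘ combine i)

column : ∀ {m n} → Subset (m * n) → Fin n → Subset m
column X j = tabulate (lookup X ∘ λ i → combine i j)

indicator : Bool → ℕ
indicator true = 1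
indicator false = 0

∣tabulate∣≡∑indicator : ∀ {n} (f : Fin n → Bool) → ∣ tabulate f ∣ ≡ ∑[ j < n ] indicator (f j)
∣tabulate∣≡∑indicator {zero} f = refl
∣tabulate∣≡∑indicator {suc n} f with f zero
... | true = cong suc (∣tabulate∣≡∑indicator (f ∘ suc))
... | false = ∣tabulate∣≡∑indicator (f ∘ suc)

∣∣-↑-split : ∀ m {n} (X : Subset (m + n)) →
             ∣ X ∣ ≡ ∣ tabulate (lookup X ∘ (_↑ˡ n)) ∣ + ∣ tabulate (lookup X ∘ (m ↑ʳ_)) ∣
∣∣-↑-split zero X = cong ∣_∣ (sym (tabulate∘lookup X))
∣∣-↑-split (suc m) (true ∷ X) = cong suc (∣∣-↑-split m X)
∣∣-↑-split (suc m) (false ∷ X) = ∣∣-↑-split m X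

∣∣≡∑∣row∣ : ∀ {m n} (X : Subset (m * n)) → ∣ X ∣ ≡ ∑[ i < m ] ∣ row {n = n} X i ∣
∣∣≡∑∣row∣ {zero} [] = refl
∣∣≡∑∣row∣ {suc m} {n} X = begin
  ∣ X ∣                                     ≡⟨ ∣∣-↑-split n X ⟩
  ∣ rowX zero ∣ + ∣ rest ∣                   ≡⟨ cong (∣ rowX zero ∣ +_) (∣∣≡∑∣row∣ {m} {n} rest) ⟩
  ∣ rowX zero ∣ + ∑[ i < m ] ∣ rowRest i ∣   ≡⟨ cong (∣ rowX zero ∣ +_) (sum-cong-≗ rowRest≡rowX) ⟩
  ∑[ i < suc m ] ∣ rowX i ∣                  ∎
  where
  open ≡-Reasoning
  rowX : Fin (suc m) → Subset n
  rowX = row X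
  rest : Subset (m * n)
  rest = tabulate (lookup X ∘ (n ↑ʳ_))
  rowRest : Fin m → Subset n
  rowRest = row rest
  rowRest≡rowX : ∀ i → ∣ rowRest i ∣ ≡ ∣ rowX (suc i) ∣
  rowRest≡rowX i = cong ∣_∣ (tabulate-cong (lookup∘tabulate _ ∘ combine {m} {n} i))

∣∣≡∑∣column∣ : ∀ {m n} (X : Subset (m * n)) → ∣ X ∣ ≡ ∑[ j < n ] ∣ column {m} X j ∣
∣∣≡∑∣column∣ {m} {n} X = begin
  ∣ X ∣                                 ≡⟨ ∣∣≡∑∣row∣ {m} {n} X ⟩
  ∑[ i < m ] ∣ row {n = n} X i ∣        ≡⟨ sum-cong-≗ (λ i → ∣tabulate∣≡∑indicator (lookup X ∘ cell i)) ⟩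
  ∑[ i < m ] ∑[ j < n ] inX (cell i j)  ≡⟨ ∑-comm (λ i j → inX (cell i j)) ⟩
  ∑[ j < n ] ∑[ i < m ] inX (cell i j)  ≡⟨ sum-cong-≗ (λ j → sym (∣tabulate∣≡∑indicator (λ i → lookup X (cell i j)))) ⟩
  ∑[ j < n ] ∣ column {m} X j ∣         ∎
  where
  open ≡-Reasoning
  cell : Fin m → Fin n → Fin (m * n)
  cell = combine
  inX : Fin (m * n) → ℕ
  inX = indicator ∘ lookup X

∑≤∣support∣* : ∀ {m B} (f : Fin m → ℕ) (T : Subset m) → (∀ i → f i ≤ B) → (∀ i → i ∉ T → f i ≡ 0) →
               ∑[ i < m ] f i ≤ ∣ T ∣ * B
∑≤∣support∣* f [] f≤B outside≡0 = z≤n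
∑≤∣support∣* f (true ∷ T) f≤B outside≡0 =
  +-mono-≤ (f≤B zero) (∑≤∣support∣* (f ∘ suc) T (f≤B ∘ suc) (λ i i∉T → outside≡0 (suc i) (i∉T ∘ drop-there)))
∑≤∣support∣* f (false ∷ T) f≤B outside≡0 rewrite outside≡0 zero (λ ()) =
  ∑≤∣support∣* (f ∘ suc) T (f≤B ∘ suc) (λ i i∉T → outside≡0 (suc i) (i∉T ∘ drop-there))

∈row⇔∈column : ∀ {m n} (X : Subset (m * n)) {i j} → j ∈ row {n = n} X i ⇔ i ∈ column {m} X j
∈row⇔∈column X {i} {j} = mk⇔ (from byColumn ∘ to byRow) (from byRow ∘ to byColumn)
  where
  open Equivalence
  byRow = ∈-tabulate∘lookup X (combine i)
  byColumn = ∈-tabulate∘lookup X (λ i → combine i j)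

rows≤B⇒∣X∣≤∣T∣*B : ∀ {m n B} (X : Subset (m * n)) (T : Subset m) →
                    (∀ i → ∣ row {n = n} X i ∣ ≤ B) → (∀ j → column {m} X j ⊆ T) → ∣ X ∣ ≤ ∣ T ∣ * B
rows≤B⇒∣X∣≤∣T∣*B {m} {n} X T rows≤B columns⊆T = begin
  ∣ X ∣                           ≡⟨ ∣∣≡∑∣row∣ {m} {n} X ⟩
  ∑[ i < m ] ∣ row {n = n} X i ∣  ≤⟨ ∑≤∣support∣* _ T rows≤B (λ i i∉T → Empty⇒∣p∣≡0 (row-empty i i∉T)) ⟩
  ∣ T ∣ * _                       ∎
  where
  open ≤-Reasoning
  row-empty : ∀ i → i ∉ T → Empty (row {n = n} X i)
  row-empty i i∉T (j , j∈row) = i∉T (columns⊆T j (Equivalence.to (∈row⇔∈column X) j∈row))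

columns≤B⇒∣X∣≤∣T∣*B : ∀ {m n B} (X : Subset (m * n)) (T : Subset n) →
                       (∀ j → ∣ column {m} X j ∣ ≤ B) → (∀ i → row {n = n} X i ⊆ T) → ∣ X ∣ ≤ ∣ T ∣ * B
columns≤B⇒∣X∣≤∣T∣*B {m} {n} X T columns≤B rows⊆T = begin
  ∣ X ∣                            ≡⟨ ∣∣≡∑∣column∣ {m} {n} X ⟩
  ∑[ j < n ] ∣ column {m} X j ∣    ≤⟨ ∑≤∣support∣* _ T columns≤B (λ j j∉T → Empty⇒∣p∣≡0 (column-empty j j∉T)) ⟩
  ∣ T ∣ * _                        ∎
  where
  open ≤-Reasoning
  column-empty : ∀ j → j ∉ T → Empty (column {m} X j)
  column-empty j j∉T (i , i∈column) = j∉T (rows⊆T i (Equivalence.from (∈row⇔∈column X) i∈column))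

module _ {G : Graph} where

  InternalAvoid-cons⁺ : ∀ {Y x y z k} (e : Adj G x y) (w : Walk G y z k) →
                        (0 < k → y ∉ Y) → InternalAvoid G Y w → InternalAvoid G Y (cons e w)
  InternalAvoid-cons⁺ e nil y∉Y _ = tt
  InternalAvoid-cons⁺ e (cons _ _) y∉Y w-avoids = y∉Y (s≤s z≤n) , w-avoids

  InternalAvoid-cons⁻ : ∀ {Y x y z k} (e : Adj G x y) (w : Walk G y z k) →
                        InternalAvoid G Y (cons e w) → (0 < k → y ∉ Y) × InternalAvoid G Y w
  InternalAvoid-cons⁻ e nil _ = (λ ()) , tt
  InternalAvoid-cons⁻ e (cons _ _) (y∉Y , w-avoids) = (λ _ → y∉Y) , w-avoids

  InternalAvoid-∪ : ∀ {Y Z x y k} (w : Walk G x y k) →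
                    InternalAvoid G Y w → InternalAvoid G Z w → InternalAvoid G (Y ∪ Z) w
  InternalAvoid-∪ nil _ _ = tt
  InternalAvoid-∪ (cons e nil) _ _ = tt
  InternalAvoid-∪ {Y} {Z} (cons e (cons e' w)) (v∉Y , avoidsY) (v∉Z , avoidsZ) =
    [ v∉Y , v∉Z ] ∘ x∈p∪q⁻ Y Z , InternalAvoid-∪ (cons e' w) avoidsY avoidsZ

  Shortest-tail : ∀ {x y z k} (e : Adj G x y) (w : Walk G y z k) → Shortest G (cons e w) → Shortest G w
  Shortest-tail e w shortest k' w' = ≤-pred (shortest (suc k') (cons e w'))

module Simplicial-properties {G : Graph} (adj-sym : ∀ x y → adj G x y ≡ adj G y x)
                             {S : Subset (n G)} (S-simplicial : IsSimplicialSet G S) where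

  Shortest⇒InternalAvoid-simplicial : ∀ {x y k} (w : Walk G x y k) → Shortest G w → InternalAvoid G S w
  Shortest⇒InternalAvoid-simplicial nil _ = tt
  Shortest⇒InternalAvoid-simplicial (cons e nil) _ = tt
  Shortest⇒InternalAvoid-simplicial {x} (cons {y = v} xv (cons {y = z} {k = k} vz w)) shortest =
    v∉S , Shortest⇒InternalAvoid-simplicial (cons vz w) (Shortest-tail xv (cons vz w) shortest)
    where
    -- x and z are equal or adjacent, so the path x v z … could be shortened.
    v∉S : v ∉ S
    v∉S v∈S with x ≟ᶠ z
    ... | yes refl = <⇒≱ (m<n⇒m<1+n (n<1+n k)) (shortest k w)
    ... | no x≢z = <⇒≱ (n<1+n (suc k)) (shortest (suc k) (cons xz w))
      where xz = Equivalence.to (S-simplicial v) v∈S x z (trans (adj-sym v x) xv) vz x≢z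

  TMV-∪-simplicial : ∀ {Y} → TotalMutualVisibility G Y → TotalMutualVisibility G (Y ∪ S)
  TMV-∪-simplicial Y-tmv x y with Y-tmv x y
  ... | k , w , shortest , avoidsY =
    k , w , shortest , InternalAvoid-∪ w avoidsY (Shortest⇒InternalAvoid-simplicial w shortest)

  TMV⊆simplicial : (∀ Y → TotalMutualVisibility G Y → ∣ Y ∣ ≤ ∣ S ∣) →
                   ∀ {Y} → TotalMutualVisibility G Y → Y ⊆ S
  TMV⊆simplicial μ≤∣S∣ {Y} Y-tmv {a} a∈Y with a ∈? S
  ... | yes a∈S = a∈S
  ... | no a∉S = ⊥-elim (<⇒≱ ∣S∣<∣Y∪S∣ (μ≤∣S∣ (Y ∪ S) (TMV-∪-simplicial Y-tmv)))
    where ∣S∣<∣Y∪S∣ = p⊂q⇒∣p∣<∣q∣ (q⊆p∪q Y S , a , p⊆p∪q S a∈Y , a∉S)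

-- P is a Cartesian product of K with a graph on C, P-vertex p being the pair (layerOf p , π p).
record CartesianFactor (P K : Graph) (C : Set) : Set where
  field
    π : Fin (n P) → Fin (n K)
    layerOf : Fin (n P) → C
    embed : C → Fin (n K) → Fin (n P)
    π-embed : ∀ c x → π (embed c x) ≡ x
    layerOf-embed : ∀ c x → layerOf (embed c x) ≡ c
    embed-π : ∀ p → embed (layerOf p) (π p) ≡ p
    adj-π : ∀ {p q} → Adj P p q → (layerOf p ≡ layerOf q × Adj K (π p) (π q)) ⊎ π p ≡ π q
    adj-embed : ∀ c {x y} → Adj K x y → Adj P (embed c x) (embed c y)

module CartesianFactor-properties {P K : Graph} {C : Set} (F : CartesianFactor P K C) where
  open CartesianFactor F

  onLayer : C → Subset (n P) → Subset (n K)
  onLayer c X = tabulate (lookup X ∘ embed c)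

  embed-walk : ∀ c {x y k} → Walk K x y k → Walk P (embed c x) (embed c y) k
  embed-walk c nil = nil
  embed-walk c (cons e w) = cons (adj-embed c e) (embed-walk c w)

  Shortcut : ∀ {p q k} → Walk P p q k → Set
  Shortcut {p} {q} {k} _ = ∃ λ k' → k' < k × Walk K (π p) (π q) k'

  InLayer : (X : Subset (n P)) → ∀ {p q k} → Walk P p q k → Set
  InLayer X {p} {q} {k} w = layerOf p ≡ layerOf q ×
    Σ (Walk K (π p) (π q) k) λ v → InternalAvoid P X w → InternalAvoid K (onLayer (layerOf p) X) v

  -- A step between layers leaves π unchanged, so it makes the projected walk shorter.
  project : ∀ X {p q k} (w : Walk P p q k) → Shortcut w ⊎ InLayer X w
  project X nil = inj₂ (refl , nil , λ _ → tt)
  project X {p} {q} (cons {y = v} {k = k} pv w) with adj-π pv | project X w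
  ... | inj₂ πp≡πv | inj₁ (k' , k'<k , u) =
    inj₁ (k' , m<n⇒m<1+n k'<k , subst (λ a → Walk K a (π q) k') (sym πp≡πv) u)
  ... | inj₂ πp≡πv | inj₂ (_ , u , _) = inj₁ (k , n<1+n k , subst (λ a → Walk K a (π q) k) (sym πp≡πv) u)
  ... | inj₁ (_ , πpv) | inj₁ (k' , k'<k , u) = inj₁ (suc k' , s≤s k'<k , cons πpv u)
  ... | inj₁ (p~v , πpv) | inj₂ (v~q , u , transfer) = inj₂ (trans p~v v~q , cons πpv u , transfer′)
    where
    πv∉layer : (0 < k → v ∉ X) → 0 < k → π v ∉ onLayer (layerOf p) X
    πv∉layer v∉X 0<k πv∈ = v∉X 0<k (subst (_∈ X) (trans (cong (λ c → embed c (π v)) p~v) (embed-π v))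
                                            (Equivalence.to (∈-tabulate∘lookup X (embed (layerOf p))) πv∈))
    transfer′ : InternalAvoid P X (cons pv w) → InternalAvoid K (onLayer (layerOf p) X) (cons πpv u)
    transfer′ avoids with InternalAvoid-cons⁻ pv w avoids
    ... | v∉X , w-avoids = InternalAvoid-cons⁺ πpv u (πv∉layer v∉X)
                             (subst (λ c → InternalAvoid K (onLayer c X) u) (sym p~v) (transfer w-avoids))

  onLayer-TMV : ∀ {X} → TotalMutualVisibility P X → ∀ c → TotalMutualVisibility K (onLayer c X)
  onLayer-TMV {X} X-tmv c x y with X-tmv (embed c x) (embed c y)
  ... | k , w , shortest , avoids with project X w
  ... | inj₁ (k' , k'<k , u) =
    ⊥-elim (<⇒≱ k'<k (shortest k' (embed-walk c (subst₂ (λ a b → Walk K a b k') (π-embed c x) (π-embed c y) u))))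
  ... | inj₂ (_ , u , transfer) = k , transport (π-embed c x) (π-embed c y) (layerOf-embed c x) u (transfer avoids)
    where
    transport : ∀ {a b c′} → a ≡ x → b ≡ y → c′ ≡ c → (u : Walk K a b k) → InternalAvoid K (onLayer c′ X) u →
                Σ (Walk K x y k) λ v → Shortest K v × InternalAvoid K (onLayer c X) v
    transport refl refl refl u u-avoids = u , (λ k'' u' → shortest k'' (embed-walk c u')) , u-avoids

≟-refl : ∀ {k} (x : Fin k) → ⌊ x ≟ᶠ x ⌋ ≡ true
≟-refl x = Equivalence.to T-≡ (fromWitness refl)

module _ (G H : Graph) where

  □-adj⁻ : ∀ p q → Adj (G □ H) p q →
           let (x , y) = remQuot (n H) p; (x' , y') = remQuot (n H) q in
           (x ≡ x' × Adj H y y') ⊎ (Adj G x x' × y ≡ y')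
  □-adj⁻ p q pq with Equivalence.to T-∨ (Equivalence.from T-≡ pq)
  ... | inj₁ t = let (x≡x' , yy') = Equivalence.to T-∧ t in inj₁ (toWitness x≡x' , Equivalence.to T-≡ yy')
  ... | inj₂ t = let (xx' , y≡y') = Equivalence.to T-∧ t in inj₂ (Equivalence.to T-≡ xx' , toWitness y≡y')

  □-adj-combine : ∀ x y x' y' → adj (G □ H) (combine x y) (combine x' y') ≡
                  (⌊ x ≟ᶠ x' ⌋ ∧ adj H y y') ∨ (adj G x x' ∧ ⌊ y ≟ᶠ y' ⌋)
  □-adj-combine x y x' y' = cong₂ productAdj (remQuot-combine x y) (remQuot-combine x' y')
    where
    productAdj : Fin (n G) × Fin (n H) → Fin (n G) × Fin (n H) → Bool
    productAdj (x , y) (x' , y') = (⌊ x ≟ᶠ x' ⌋ ∧ adj H y y') ∨ (adj G x x' ∧ ⌊ y ≟ᶠ y' ⌋)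

  □-adjʳ : ∀ x {y y'} → Adj H y y' → Adj (G □ H) (combine x y) (combine x y')
  □-adjʳ x {y} {y'} yy' rewrite □-adj-combine x y x y' | ≟-refl x | yy' = refl

  □-adjˡ : ∀ y {x x'} → Adj G x x' → Adj (G □ H) (combine x y) (combine x' y)
  □-adjˡ y {x} {x'} xx' rewrite □-adj-combine x y x' y | ≟-refl y | xx' = ∨-zeroʳ _

  □-rightFactor : CartesianFactor (G □ H) H (Fin (n G))
  □-rightFactor = record
    { π = proj₂ ∘ remQuot {n G} (n H)
    ; layerOf = proj₁ ∘ remQuot {n G} (n H)
    ; embed = combine
    ; π-embed = λ x y → cong proj₂ (remQuot-combine x y)
    ; layerOf-embed = λ x y → cong proj₁ (remQuot-combine x y)
    ; embed-π = combine-remQuot {n G} (n H)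
    ; adj-π = λ {p} {q} pq → [ inj₁ , inj₂ ∘ proj₂ ] (□-adj⁻ p q pq)
    ; adj-embed = □-adjʳ
    }

  □-leftFactor : CartesianFactor (G □ H) G (Fin (n H))
  □-leftFactor = record
    { π = proj₁ ∘ remQuot {n G} (n H)
    ; layerOf = proj₂ ∘ remQuot {n G} (n H)
    ; embed = λ y x → combine x y
    ; π-embed = λ y x → cong proj₁ (remQuot-combine x y)
    ; layerOf-embed = λ y x → cong proj₂ (remQuot-combine x y)
    ; embed-π = combine-remQuot {n G} (n H)
    ; adj-π = λ {p} {q} pq → [ inj₂ ∘ proj₁ , (λ (xx' , y≡y') → inj₁ (y≡y' , xx')) ] (□-adj⁻ p q pq)
    ; adj-embed = □-adjˡ
    }

  □-row-TMV : ∀ {X} → TotalMutualVisibility (G □ H) X → ∀ i → TotalMutualVisibility H (row X i)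
  □-row-TMV = CartesianFactor-properties.onLayer-TMV □-rightFactor

  □-column-TMV : ∀ {X} → TotalMutualVisibility (G □ H) X → ∀ j → TotalMutualVisibility G (column X j)
  □-column-TMV = CartesianFactor-properties.onLayer-TMV □-leftFactor

theorem5p4 : (G H : Graph) → Simple G → Simple H → Connected G → Connected H →
    (SG : Subset (n G)) → IsSimplicialSet G SG →
    (SH : Subset (n H)) → IsSimplicialSet H SH →
    (mG mH mGH : ℕ) → IsMuT G mG → IsMuT H mH → IsMuT (G □ H) mGH →
    (mG ≡ ∣ SG ∣ ⊎ mH ≡ ∣ SH ∣) → mGH ≤ mG * mH
theorem5p4 G H (G-sym , _) _ _ _ SG SG-simplicial _ _ _ _ _
           (_ , μG-max) (_ , μH-max) ((X , X-tmv , refl) , _) (inj₁ refl) =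
  rows≤B⇒∣X∣≤∣T∣*B X SG (λ i → μH-max _ (□-row-TMV G H X-tmv i))
    (λ j → TMV⊆simplicial μG-max (□-column-TMV G H X-tmv j))
  where open Simplicial-properties G-sym SG-simplicial
theorem5p4 G H _ (H-sym , _) _ _ _ _ SH SH-simplicial mG _ _
           (_ , μG-max) (_ , μH-max) ((X , X-tmv , refl) , _) (inj₂ refl) =
  subst (∣ X ∣ ≤_) (*-comm ∣ SH ∣ mG)
    (columns≤B⇒∣X∣≤∣T∣*B X SH (λ j → μG-max _ (□-column-TMV G H X-tmv j))
      (λ i → TMV⊆simplicial μH-max (□-row-TMV G H X-tmv i)))
  where open Simplicial-properties H-sym SH-simplicial
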